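{- Let $H$ be a regular, strictly $2$-balanced graph with $v_H \ge 4$. Let $\{x,y\}$ be an edge of $H$ and let $a, a'$ be two distinct vertices of $H$ with $a,a' \notin \{x,y\}$. Then there is a path from $a$ to $a'$ in $H$ that avoids the vertices $x$ and $y$.
   Context: For a graph $F$, $v_F$ and $e_F$ denote its numbers of vertices and edges. A graph $H$ is strictly $2$-balanced if $v_H, e_H \ge 3$ and for every proper subgraph $F \subsetneq H$ with $v_F \ge 3$, $(e_H-1)/(v_H-2) > (e_F-1)/(v_F-2)$. -}

module Defs where

open import Data.Nat using (ℕ; _<ᵇ_; _≥_)
open import Data.Bool using (Bool; true; false; if_then_else_; _∧_; T)
open import Data.Fin using (Fin; toℕ)
open import Data.Fin.Subset using (Subset; _∈_; ⊤) renaming (∣_∣ to size)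
open import Data.List using (List; []; _∷_; map; allFin)
open import Data.Nat.ListAction using (sum)
open import Data.List.Relation.Unary.Unique.Propositional using (Unique)
open import Data.List.Relation.Unary.All using (All)
open import Data.Product using (Σ; ∃; _×_)
open import Data.Sum using (_⊎_)
open import Data.Integer as ℤ using (ℤ; +_)
open import Relation.Binary.PropositionalEquality using (_≡_; _≢_)
open import Relation.Nullary using (¬_)

record Graph : Set where
  field
    n     : ℕ
    adj   : Fin n → Fin n → Bool
    sym   : ∀ i j → adj i j ≡ adj j i
    loopless : ∀ i → adj i i ≡ false
open Graph public

countPairs : ∀ {m} → (Fin m → Fin m → Bool) → ℕ
countPairs {m} E =
  sum (map (λ i → sum (map (λ j → if (toℕ i <ᵇ toℕ j) ∧ E i j then 1 else 0)
                           (allFin m)))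
           (allFin m))

vCount : Graph → ℕ
vCount H = n H

eCount : Graph → ℕ
eCount H = countPairs (adj H)

degree : (H : Graph) → Fin (n H) → ℕ
degree H i = sum (map (λ j → if adj H i j then 1 else 0) (allFin (n H)))

Regular : Graph → Set
Regular H = ∃ λ d → ∀ i → degree H i ≡ d

record Subgraph (H : Graph) : Set where
  field
    S    : Subset (n H)
    E    : Fin (n H) → Fin (n H) → Bool
    Esym : ∀ i j → E i j ≡ E j i
    E⊆H  : ∀ i j → T (E i j) → T (adj H i j)
    E⊆S  : ∀ i j → T (E i j) → i ∈ S
open Subgraph public

subV : ∀ {H} → Subgraph H → ℕ
subV F = size (S F)

subE : ∀ {H} → Subgraph H → ℕ
subE F = countPairs (E F)

Proper : ∀ {H} → Subgraph H → Set
Proper {H} F = (Σ (Fin (n H)) λ i → ¬ (i ∈ S F))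
             ⊎ (Σ (Fin (n H)) λ i → Σ (Fin (n H)) λ j → T (adj H i j) × ¬ T (E F i j))

-- (eH - 1)/(vH - 2) > (eF - 1)/(vF - 2), cross-multiplied over ℤ
-- (valid since vH - 2 > 0 and vF - 2 > 0).
ratioGreater : (eH vH eF vF : ℕ) → Set
ratioGreater eH vH eF vF =
  ((+ eF) ℤ.- + 1) ℤ.* ((+ vH) ℤ.- + 2) ℤ.< ((+ eH) ℤ.- + 1) ℤ.* ((+ vF) ℤ.- + 2)

Strictly2Balanced : Graph → Set
Strictly2Balanced H =
  vCount H ≥ 3 × eCount H ≥ 3 ×
  (∀ (F : Subgraph H) → Proper F → subV F ≥ 3 →
     ratioGreater (eCount H) (vCount H) (subE F) (subV F))

data IsWalk (H : Graph) : Fin (n H) → Fin (n H) → List (Fin (n H)) → Set where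
  single : ∀ a → IsWalk H a a (a ∷ [])
  step   : ∀ {b c vs} a → T (adj H a b) → IsWalk H b c (b ∷ vs) →
           IsWalk H a c (a ∷ b ∷ vs)

PathAvoiding : (H : Graph) → (a b x y : Fin (n H)) → Set
PathAvoiding H a b x y =
  Σ (List (Fin (n H))) λ vs →
    IsWalk H a b vs × Unique vs × All (λ v → v ≢ x × v ≢ y) vs

module Submission where

-- Let C be the set of vertices joined to a′ by a walk avoiding x and y; it is computed
-- as a post-fixed point of a monotone "add every avoiding neighbour" operator on Boolean
-- vertex sets.  If a ∈ C, shortening such a walk gives the required path.  Otherwise
-- the induced subgraphs F₁ = H[C ∪ {x,y}] and F₂ = H[∁ C] cover every edge of H (no edge
-- leaves C except towards x or y) and intersect exactly in H[{x,y}], the single edge xy.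
-- Inclusion–exclusion then gives v₁ + v₂ = v_H + 2 and e₁ + e₂ = e_H + 1.  Both F₁ (it
-- misses a) and F₂ (it misses a′) are proper with at least three vertices, so strict
-- 2-balancedness gives (e₁ - 1)(v_H - 2) < (e_H - 1)(v₁ - 2) and the same for F₂; adding
-- the two inequalities contradicts the two identities.

open import Defs renaming (sym to adj-sym)

module RatioArithmetic where
  open import Data.Empty using (⊥)
  open import Data.Integer using (ℤ; +_; _+_; _-_; _*_)
  import Data.Integer.Properties as ℤₚ
  open import Data.Integer.Tactic.RingSolver using (solve-∀)
  import Data.Nat as ℕ
  open import Relation.Binary.PropositionalEquality using (_≡_; cong; module ≡-Reasoning)

  ratio-sum-impossible : ∀ e v e₁ v₁ e₂ v₂ → e₁ ℕ.+ e₂ ≡ e ℕ.+ 1 → v₁ ℕ.+ v₂ ≡ v ℕ.+ 2 →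
    ratioGreater e v e₁ v₁ → ratioGreater e v e₂ v₂ → ⊥
  ratio-sum-impossible e v e₁ v₁ e₂ v₂ edges vertices r₁ r₂ =
    ℤₚ.<-irrefl balance (ℤₚ.+-mono-< r₁ r₂)
    where
    open ≡-Reasoning
    factor : ∀ (a b w : ℤ) → (a - + 1) * w + (b - + 1) * w ≡ ((a + b) - + 2) * w
    factor = solve-∀
    shift : ∀ (c w : ℤ) → ((c + + 1) - + 2) * (w - + 2) ≡ (c - + 1) * ((w + + 2) - + 4)
    shift = solve-∀
    expand : ∀ (c u₁ u₂ : ℤ) → c * ((u₁ + u₂) - + 4) ≡ c * (u₁ - + 2) + c * (u₂ - + 2)
    expand = solve-∀
    balance : (+ e₁ - + 1) * (+ v - + 2) + (+ e₂ - + 1) * (+ v - + 2)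
            ≡ (+ e - + 1) * (+ v₁ - + 2) + (+ e - + 1) * (+ v₂ - + 2)
    balance = begin
      (+ e₁ - + 1) * (+ v - + 2) + (+ e₂ - + 1) * (+ v - + 2)
        ≡⟨ factor (+ e₁) (+ e₂) (+ v - + 2) ⟩
      ((+ e₁ + + e₂) - + 2) * (+ v - + 2)
        ≡⟨ cong (λ z → (z - + 2) * (+ v - + 2)) (ℤₚ.pos-+ e₁ e₂) ⟨
      (+ (e₁ ℕ.+ e₂) - + 2) * (+ v - + 2)
        ≡⟨ cong (λ z → (+ z - + 2) * (+ v - + 2)) edges ⟩
      (+ (e ℕ.+ 1) - + 2) * (+ v - + 2)
        ≡⟨ cong (λ z → (z - + 2) * (+ v - + 2)) (ℤₚ.pos-+ e 1) ⟩
      ((+ e + + 1) - + 2) * (+ v - + 2)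
        ≡⟨ shift (+ e) (+ v) ⟩
      (+ e - + 1) * ((+ v + + 2) - + 4)
        ≡⟨ cong (λ z → (+ e - + 1) * (z - + 4)) (ℤₚ.pos-+ v 2) ⟨
      (+ e - + 1) * (+ (v ℕ.+ 2) - + 4)
        ≡⟨ cong (λ z → (+ e - + 1) * (+ z - + 4)) vertices ⟨
      (+ e - + 1) * (+ (v₁ ℕ.+ v₂) - + 4)
        ≡⟨ cong (λ z → (+ e - + 1) * (z - + 4)) (ℤₚ.pos-+ v₁ v₂) ⟩
      (+ e - + 1) * ((+ v₁ + + v₂) - + 4)
        ≡⟨ expand (+ e - + 1) (+ v₁) (+ v₂) ⟩
      (+ e - + 1) * (+ v₁ - + 2) + (+ e - + 1) * (+ v₂ - + 2)
        ∎

open RatioArithmetic using (ratio-sum-impossible)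

import Algebra.Properties.CommutativeSemigroup as CommutativeSemigroupProperties
open import Algebra.Bundles using (CommutativeMonoid)
open import Data.Bool using (Bool; true; false; T; if_then_else_; _∧_; _∨_; not)
open import Data.Bool.Properties using (T?; T-∧; T-∨; T-≡; ∨-comm; ∧-comm; ∧-commutativeMonoid)
open import Data.Empty using (⊥; ⊥-elim)
open import Data.Fin as Fin using (Fin; zero; suc; toℕ)
import Data.Fin.Properties as Finₚ
open import Data.Fin.Subset using () renaming (_∈_ to _∈ₛ_; ∣_∣ to size)
open import Data.List as List using (List; []; _∷_; allFin)
import Data.List.Properties as Listₚ
open import Data.List.Membership.Propositional using (_∈_)
import Data.List.Membership.DecPropositional as DecMembership
open import Data.List.Relation.Unary.All using (All; []; _∷_)
open import Data.List.Relation.Unary.All.Properties using (¬Any⇒All¬)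
open import Data.List.Relation.Unary.AllPairs using ([]; _∷_)
open import Data.List.Relation.Unary.Any using (here; there)
open import Data.List.Relation.Unary.Unique.Propositional using (Unique)
open import Data.Nat as ℕ using (ℕ; _+_; _≤_; _<_; _≥_; z≤n; s≤s; _<ᵇ_)
open import Data.Nat.ListAction as ListAction using ()
open import Data.Nat.Properties as ℕₚ using (≤-trans; ≤-reflexive; +-mono-≤)
open import Data.Product using (Σ; ∃; _×_; _,_; proj₁; proj₂; uncurry)
open import Data.Sum using (_⊎_; inj₁; inj₂)
open import Data.Unit using (tt)
import Data.Vec as Vec
import Data.Vec.Properties as Vecₚ
open import Function using (_∘_; id)
open import Function.Bundles using (Equivalence)
open import Relation.Binary.Definitions using (tri<; tri≈; tri>)
open import Relation.Binary.PropositionalEquality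
  using (_≡_; _≢_; refl; sym; trans; cong; cong₂; subst; subst₂; module ≡-Reasoning)
open import Relation.Nullary using (¬_; yes; no)
open import Relation.Nullary.Decidable
  using (Dec; isYes; toWitness; fromWitness; decidable-stable; ¬?; _×-dec_; _→-dec_)
open import Relation.Unary using (Decidable)
open import Algebra.Properties.CommutativeMonoid.Sum ℕₚ.+-0-commutativeMonoid
  using (sum-cong-≗; ∑-distrib-+) renaming (sum to ∑)

open Equivalence using (to; from)

-- Finite sums over Fin m and 0/1 indicators

ind : Bool → ℕ
ind b = if b then 1 else 0

ind-true : ∀ {b} → T b → ind b ≡ 1
ind-true {true} _ = refl

ind-false : ∀ {b} → ¬ T b → ind b ≡ 0
ind-false {true} ¬b = ⊥-elim (¬b tt)
ind-false {false} _ = refl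

ind-mono : ∀ {a b} → (T a → T b) → ind a ≤ ind b
ind-mono {false} _ = z≤n
ind-mono {true} a⇒b = ≤-reflexive (sym (ind-true (a⇒b tt)))

∑-allFin : ∀ {m} (g : Fin m → ℕ) → ListAction.sum (List.map g (allFin m)) ≡ ∑ g
∑-allFin g = trans (cong ListAction.sum (Listₚ.map-tabulate id g)) (sum-tabulate g)
  where
  sum-tabulate : ∀ {m} (g : Fin m → ℕ) → ListAction.sum (List.tabulate g) ≡ ∑ g
  sum-tabulate {ℕ.zero} g = refl
  sum-tabulate {ℕ.suc m} g = cong (g zero +_) (sum-tabulate (g ∘ suc))

∑-zero : ∀ {m} (f : Fin m → ℕ) → (∀ i → f i ≡ 0) → ∑ f ≡ 0
∑-zero {ℕ.zero} f _ = refl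
∑-zero {ℕ.suc m} f f≡0 = cong₂ _+_ (f≡0 zero) (∑-zero (f ∘ suc) (f≡0 ∘ suc))

∑-point : ∀ {m} (f : Fin m → ℕ) (p : Fin m) → (∀ i → i ≢ p → f i ≡ 0) → ∑ f ≡ f p
∑-point f zero away = trans (cong (f zero +_) (∑-zero (f ∘ suc) (λ i → away (suc i) λ ())))
                            (ℕₚ.+-identityʳ (f zero))
∑-point f (suc p) away =
  trans (cong (_+ ∑ (f ∘ suc)) (away zero λ ()))
        (∑-point (f ∘ suc) p (λ i i≢p → away (suc i) (i≢p ∘ Finₚ.suc-injective)))

∑-ones : ∀ {m} → ∑ {m} (λ _ → 1) ≡ m
∑-ones {ℕ.zero} = refl
∑-ones {ℕ.suc m} = cong ℕ.suc (∑-ones {m})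

∑-mono : ∀ {m} {f g : Fin m → ℕ} → (∀ i → f i ≤ g i) → ∑ f ≤ ∑ g
∑-mono {ℕ.zero} _ = z≤n
∑-mono {ℕ.suc m} f≤g = +-mono-≤ (f≤g zero) (∑-mono (f≤g ∘ suc))

∑-mono-< : ∀ {m} {f g : Fin m → ℕ} → (∀ i → f i ≤ g i) → (p : Fin m) → f p < g p → ∑ f < ∑ g
∑-mono-< f≤g zero fp<gp = ℕₚ.+-mono-<-≤ fp<gp (∑-mono (f≤g ∘ suc))
∑-mono-< f≤g (suc p) fp<gp = ℕₚ.+-mono-≤-< (f≤g zero) (∑-mono-< (f≤g ∘ suc) p fp<gp)

∑∑ : ∀ {m} → (Fin m → Fin m → ℕ) → ℕ
∑∑ f = ∑ λ i → ∑ (f i)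

∑∑-+ : ∀ {m} (f g : Fin m → Fin m → ℕ) → ∑∑ (λ i j → f i j + g i j) ≡ ∑∑ f + ∑∑ g
∑∑-+ f g = trans (sum-cong-≗ (λ i → ∑-distrib-+ (f i) (g i)))
                  (∑-distrib-+ (λ i → ∑ (f i)) (λ i → ∑ (g i)))

∑∑-cong : ∀ {m} {f g : Fin m → Fin m → ℕ} → (∀ i j → f i j ≡ g i j) → ∑∑ f ≡ ∑∑ g
∑∑-cong f≡g = sum-cong-≗ (λ i → sum-cong-≗ (f≡g i))

-- Boolean vertex sets

BoolSet : ℕ → Set
BoolSet m = Fin m → Bool

∣_∣ : ∀ {m} → BoolSet m → ℕ
∣ s ∣ = ∑ (ind ∘ s)

_⊆_ : ∀ {m} → BoolSet m → BoolSet m → Set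
s ⊆ t = ∀ i → T (s i) → T (t i)

_∪_ _∩_ : ∀ {m} → BoolSet m → BoolSet m → BoolSet m
(s ∪ t) i = s i ∨ t i
(s ∩ t) i = s i ∧ t i

∁ : ∀ {m} → BoolSet m → BoolSet m
∁ s i = not (s i)

⦅_⦆ : ∀ {m} → Fin m → BoolSet m
⦅ p ⦆ i = isYes (i Fin.≟ p)

pair : ∀ {m} → Fin m → Fin m → BoolSet m
pair p q = ⦅ p ⦆ ∪ ⦅ q ⦆

-- Membership in a Boolean set is not inferable from its type, so the elementary
-- introduction and elimination rules take the set and the point explicitly.
∪-introˡ : ∀ {m} (s t : BoolSet m) i → T (s i) → T ((s ∪ t) i)
∪-introˡ s t i si = from (T-∨ {s i} {t i}) (inj₁ si)

∪-introʳ : ∀ {m} (s t : BoolSet m) i → T (t i) → T ((s ∪ t) i)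
∪-introʳ s t i ti = from (T-∨ {s i} {t i}) (inj₂ ti)

∪-elim : ∀ {m} (s t : BoolSet m) i → T ((s ∪ t) i) → T (s i) ⊎ T (t i)
∪-elim s t i = to (T-∨ {s i} {t i})

∩-elim : ∀ {m} (s t : BoolSet m) i → T ((s ∩ t) i) → T (s i) × T (t i)
∩-elim s t i = to (T-∧ {s i} {t i})

∁-intro : ∀ {m} (s : BoolSet m) i → ¬ T (s i) → T (∁ s i)
∁-intro s i ¬si with s i
... | true = ¬si tt
... | false = tt

∁-elim : ∀ {m} (s : BoolSet m) i → T (∁ s i) → ¬ T (s i)
∁-elim s i i∈∁s with s i
... | true = λ _ → i∈∁s
... | false = λ ()

∈⦅⦆ : ∀ {m} (p : Fin m) → T (⦅ p ⦆ p)
∈⦅⦆ p = fromWitness refl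

∈⦅⦆⇒≡ : ∀ {m} (p i : Fin m) → T (⦅ p ⦆ i) → i ≡ p
∈⦅⦆⇒≡ p i = toWitness {a? = i Fin.≟ p}

∈pair⇒ : ∀ {m} (p q i : Fin m) → T (pair p q i) → i ≡ p ⊎ i ≡ q
∈pair⇒ p q i i∈ with ∪-elim ⦅ p ⦆ ⦅ q ⦆ i i∈
... | inj₁ i∈p = inj₁ (∈⦅⦆⇒≡ p i i∈p)
... | inj₂ i∈q = inj₂ (∈⦅⦆⇒≡ q i i∈q)

∉pair : ∀ {m} {p q i : Fin m} → i ≢ p → i ≢ q → ¬ T (pair p q i)
∉pair {p = p} {q} {i} i≢p i≢q i∈ with ∈pair⇒ p q i i∈
... | inj₁ i≡p = i≢p i≡p
... | inj₂ i≡q = i≢q i≡q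

∣∣-cong : ∀ {m} {s t : BoolSet m} → (∀ i → s i ≡ t i) → ∣ s ∣ ≡ ∣ t ∣
∣∣-cong s≡t = sum-cong-≗ (cong ind ∘ s≡t)

∣∣≤ : ∀ {m} (s : BoolSet m) → ∣ s ∣ ≤ m
∣∣≤ s = ≤-trans (∑-mono (λ i → ind-mono {s i} {true} (λ _ → tt))) (≤-reflexive ∑-ones)

∣∣-full : ∀ {m} {s : BoolSet m} → (∀ i → T (s i)) → ∣ s ∣ ≡ m
∣∣-full all-in = trans (sum-cong-≗ (ind-true ∘ all-in)) ∑-ones

∣∣-< : ∀ {m} {s t : BoolSet m} {p} → s ⊆ t → T (t p) → ¬ T (s p) → ∣ s ∣ < ∣ t ∣
∣∣-< {s = s} {t} {p} s⊆t tp ¬sp =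
  ∑-mono-< (λ i → ind-mono (s⊆t i)) p
    (subst₂ _<_ (sym (ind-false ¬sp)) (sym (ind-true tp)) (s≤s z≤n))

∣∣-inclusion-exclusion : ∀ {m} (s t : BoolSet m) → ∣ s ∣ + ∣ t ∣ ≡ ∣ s ∪ t ∣ + ∣ s ∩ t ∣
∣∣-inclusion-exclusion s t = begin
  ∣ s ∣ + ∣ t ∣                                     ≡⟨ ∑-distrib-+ (ind ∘ s) (ind ∘ t) ⟨
  ∑ (λ i → ind (s i) + ind (t i))                  ≡⟨ sum-cong-≗ (λ i → pointwise (s i) (t i)) ⟩
  ∑ (λ i → ind ((s ∪ t) i) + ind ((s ∩ t) i))      ≡⟨ ∑-distrib-+ (ind ∘ (s ∪ t)) (ind ∘ (s ∩ t)) ⟩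
  ∣ s ∪ t ∣ + ∣ s ∩ t ∣                             ∎
  where
  open ≡-Reasoning
  pointwise : ∀ a b → ind a + ind b ≡ ind (a ∨ b) + ind (a ∧ b)
  pointwise false false = refl
  pointwise false true = refl
  pointwise true false = refl
  pointwise true true = refl

∣⦅⦆∣ : ∀ {m} (p : Fin m) → ∣ ⦅ p ⦆ ∣ ≡ 1
∣⦅⦆∣ p = trans (∑-point (ind ∘ ⦅ p ⦆) p (λ i i≢p → ind-false {⦅ p ⦆ i} (i≢p ∘ ∈⦅⦆⇒≡ p i)))
               (ind-true (∈⦅⦆ p))

∣pair∣ : ∀ {m} {p q : Fin m} → p ≢ q → ∣ pair p q ∣ ≡ 2
∣pair∣ {p = p} {q} p≢q = begin
  ∣ pair p q ∣                          ≡⟨ ℕₚ.+-identityʳ _ ⟨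
  ∣ pair p q ∣ + 0                      ≡⟨ cong (∣ pair p q ∣ +_) disjoint ⟨
  ∣ pair p q ∣ + ∣ ⦅ p ⦆ ∩ ⦅ q ⦆ ∣      ≡⟨ ∣∣-inclusion-exclusion ⦅ p ⦆ ⦅ q ⦆ ⟨
  ∣ ⦅ p ⦆ ∣ + ∣ ⦅ q ⦆ ∣                 ≡⟨ cong₂ _+_ (∣⦅⦆∣ p) (∣⦅⦆∣ q) ⟩
  2                                     ∎
  where
  open ≡-Reasoning
  disjoint : ∣ ⦅ p ⦆ ∩ ⦅ q ⦆ ∣ ≡ 0
  disjoint = ∑-zero (ind ∘ (⦅ p ⦆ ∩ ⦅ q ⦆)) λ i → ind-false {(⦅ p ⦆ ∩ ⦅ q ⦆) i} λ both →
    let ip , iq = ∩-elim ⦅ p ⦆ ⦅ q ⦆ i both in p≢q (trans (sym (∈⦅⦆⇒≡ p i ip)) (∈⦅⦆⇒≡ q i iq))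

∣∣-three : ∀ {m} {s : BoolSet m} {p q r} → p ≢ q → pair p q ⊆ s → T (s r) → r ≢ p → r ≢ q →
           3 ≤ ∣ s ∣
∣∣-three p≢q pair⊆s sr r≢p r≢q =
  subst (_< _) (∣pair∣ p≢q) (∣∣-< pair⊆s sr (∉pair r≢p r≢q))

-- Walks and paths

walk-cons : ∀ {H : Graph} {v u c vs} → T (adj H v u) → IsWalk H u c vs → IsWalk H v c (v ∷ vs)
walk-cons vu (single u) = step _ vu (single u)
walk-cons vu (step u uw w) = step _ vu (step u uw w)

walk-head : ∀ {H : Graph} {P : Fin (n H) → Set} {v c vs} → IsWalk H v c vs → All P vs → P v
walk-head (single _) (pv ∷ _) = pv
walk-head (step _ _ _) (pv ∷ _) = pv

module Paths (H : Graph) (P : Fin (n H) → Set) where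
  open DecMembership (Fin._≟_ {n H}) using (_∈?_)

  PathIn : Fin (n H) → Fin (n H) → Set
  PathIn a c = Σ (List (Fin (n H))) λ vs → IsWalk H a c vs × Unique vs × All P vs

  path-suffix : ∀ {a b c ws} → IsWalk H b c ws → a ∈ ws → Unique ws → All P ws → PathIn a c
  path-suffix w@(single _) (here refl) u ps = _ , w , u , ps
  path-suffix w@(step _ _ _) (here refl) u ps = _ , w , u , ps
  path-suffix (step _ _ w) (there a∈) (_ ∷ u) (_ ∷ ps) = path-suffix w a∈ u ps

  -- Shorten the tail first; if the head already occurs on it, cut the loop by jumping
  -- to that occurrence, otherwise prepend the head.
  walk⇒path : ∀ {a c vs} → IsWalk H a c vs → All P vs → PathIn a c
  walk⇒path (single a) (pa ∷ []) = _ , single a , [] ∷ [] , pa ∷ []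
  walk⇒path {a} (step _ ab w) (pa ∷ ps) with walk⇒path w ps
  ... | ws , w′ , u , ps′ with a ∈? ws
  ...   | yes a∈ = path-suffix w′ a∈ u ps′
  ...   | no a∉ = a ∷ ws , walk-cons ab w′ , ¬Any⇒All¬ ws a∉ ∷ u , pa ∷ ps′

saturate : ∀ {m} (grow : BoolSet m → BoolSet m) → (∀ R → R ⊆ grow R) →
           (Inv : BoolSet m → Set) → (∀ R → Inv R → Inv (grow R)) →
           ∀ R → Inv R → Σ (BoolSet m) λ R′ → Inv R′ × R ⊆ R′ × grow R′ ⊆ R′
saturate {m} grow inflationary Inv preserved R inv =
  iterate (ℕ.suc m) R (s≤s (ℕₚ.m≤m+n m ∣ R ∣)) inv
  where
  stable? : ∀ R → Dec (grow R ⊆ R)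
  stable? R = Finₚ.all? (λ v → T? (grow R v) →-dec T? (R v))

  -- The fuel k bounds the number of remaining strict enlargements of R.
  iterate : ∀ k R → m < k + ∣ R ∣ → Inv R → Σ (BoolSet m) λ R′ → Inv R′ × R ⊆ R′ × grow R′ ⊆ R′
  iterate k R bound inv with stable? R
  ... | yes stable = R , inv , (λ _ r → r) , stable
  iterate ℕ.zero R bound inv | no _ = ⊥-elim (ℕₚ.<⇒≱ bound (∣∣≤ R))
  iterate (ℕ.suc k) R bound inv | no unstable
    with Finₚ.¬∀⟶∃¬ m _ (λ v → T? (grow R v) →-dec T? (R v)) unstable
  ... | v , v-new with iterate k (grow R) bound′ (preserved R inv)
    where
    growth : ∣ R ∣ < ∣ grow R ∣
    growth = ∣∣-< (inflationary R)
                  (decidable-stable (T? (grow R v)) (λ ¬g → v-new (λ g → ⊥-elim (¬g g))))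
                  (λ r → v-new (λ _ → r))
    bound′ : m < k + ∣ grow R ∣
    bound′ = ≤-trans bound (≤-trans (≤-reflexive (sym (ℕₚ.+-suc k ∣ R ∣)))
                                    (ℕₚ.+-monoʳ-≤ k growth))
  ...   | R′ , inv′ , grow⊆R′ , stable = R′ , inv′ , (λ i r → grow⊆R′ i (inflationary R i r)) , stable

module Component (H : Graph) {P : Fin (n H) → Set} (P? : Decidable P) (t : Fin (n H)) where

  WalksToTarget : BoolSet (n H) → Set
  WalksToTarget R = ∀ v → T (R v) → Σ (List (Fin (n H))) λ vs → IsWalk H v t vs × All P vs

  Extends : BoolSet (n H) → Fin (n H) → Set
  Extends R v = P v × ∃ λ u → T (adj H v u) × T (R u)

  extends? : ∀ R v → Dec (Extends R v)
  extends? R v = P? v ×-dec Finₚ.any? (λ u → T? (adj H v u) ×-dec T? (R u))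

  grow : BoolSet (n H) → BoolSet (n H)
  grow R = R ∪ (isYes ∘ extends? R)

  grow-walks : ∀ R → WalksToTarget R → WalksToTarget (grow R)
  grow-walks R walks v v∈ with ∪-elim R (isYes ∘ extends? R) v v∈
  ... | inj₁ v∈R = walks v v∈R
  ... | inj₂ new with toWitness {a? = extends? R v} new
  ...   | pv , u , vu , u∈R with walks u u∈R
  ...     | vs , w , ps = v ∷ vs , walk-cons vu w , pv ∷ ps

  component : P t → Σ (BoolSet (n H)) λ C →
              WalksToTarget C × T (C t) × (∀ u v → T (C u) → T (adj H v u) → P v → T (C v))
  component pt with saturate grow (λ R → ∪-introˡ R (isYes ∘ extends? R)) WalksToTarget grow-walks ⦅ t ⦆ start
    where
    start : WalksToTarget ⦅ t ⦆
    start v v∈ with ∈⦅⦆⇒≡ t v v∈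
    ... | refl = t ∷ [] , single t , pt ∷ []
  ... | C , walks , t⊆C , closed =
    C , walks , t⊆C t (∈⦅⦆ t) ,
    λ u v u∈C vu pv → closed v (∪-introʳ C (isYes ∘ extends? C) v (fromWitness (pv , u , vu , u∈C)))

-- Induced subgraphs and inclusion–exclusion for their vertex and edge counts

loop-free : ∀ (H : Graph) {i} → ¬ T (adj H i i)
loop-free H {i} = subst T (loopless H i)

adj⇒≢ : ∀ (H : Graph) {i j} → T (adj H i j) → i ≢ j
adj⇒≢ H ij refl = loop-free H ij

adj-flip : ∀ (H : Graph) {i j} → T (adj H i j) → T (adj H j i)
adj-flip H {i} {j} = subst T (adj-sym H i j)

tabulate-∈ : ∀ {m} (s : BoolSet m) {i} → T (s i) → i ∈ₛ Vec.tabulate s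
tabulate-∈ s {i} si = Vecₚ.lookup⇒[]= i (Vec.tabulate s) (trans (Vecₚ.lookup∘tabulate s i) (to T-≡ si))

tabulate-∉ : ∀ {m} (s : BoolSet m) {i} → ¬ T (s i) → ¬ (i ∈ₛ Vec.tabulate s)
tabulate-∉ s {i} ¬si i∈ = ¬si (from T-≡ (trans (sym (Vecₚ.lookup∘tabulate s i)) (Vecₚ.[]=⇒lookup i∈)))

size-tabulate : ∀ {m} (s : BoolSet m) → size (Vec.tabulate s) ≡ ∣ s ∣
size-tabulate {ℕ.zero} s = refl
size-tabulate {ℕ.suc m} s with s zero
... | true = cong ℕ.suc (size-tabulate (s ∘ suc))
... | false = size-tabulate (s ∘ suc)

before : ∀ {m} → Fin m → Fin m → Bool
before i j = toℕ i <ᵇ toℕ j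

before-asym : ∀ {m} {i j : Fin m} → T (before i j) → ¬ T (before j i)
before-asym {i = i} {j} ij ji =
  ℕₚ.<-asym (ℕₚ.<ᵇ⇒< (toℕ i) (toℕ j) ij) (ℕₚ.<ᵇ⇒< (toℕ j) (toℕ i) ji)

countPairs-∑ : ∀ {m} (E : Fin m → Fin m → Bool) → countPairs E ≡ ∑∑ (λ i j → ind (before i j ∧ E i j))
countPairs-∑ {m} E =
  trans (∑-allFin (λ i → ListAction.sum (List.map (λ j → ind (before i j ∧ E i j)) (allFin m))))
        (sum-cong-≗ (λ i → ∑-allFin (λ j → ind (before i j ∧ E i j))))

countPairs-cong : ∀ {m} {E E′ : Fin m → Fin m → Bool} → (∀ i j → E i j ≡ E′ i j) →
                  countPairs E ≡ countPairs E′
countPairs-cong {E = E} {E′} E≡E′ = begin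
  countPairs E                                   ≡⟨ countPairs-∑ E ⟩
  ∑∑ (λ i j → ind (before i j ∧ E i j))
    ≡⟨ ∑∑-cong (λ i j → cong (λ b → ind (before i j ∧ b)) (E≡E′ i j)) ⟩
  ∑∑ (λ i j → ind (before i j ∧ E′ i j))         ≡⟨ countPairs-∑ E′ ⟨
  countPairs E′                                  ∎
  where open ≡-Reasoning

countPairs-balance : ∀ {m} (E₁ E₂ E₃ E₄ : Fin m → Fin m → Bool) →
  (∀ i j → ind (E₁ i j) + ind (E₂ i j) ≡ ind (E₃ i j) + ind (E₄ i j)) →
  countPairs E₁ + countPairs E₂ ≡ countPairs E₃ + countPairs E₄
countPairs-balance {m} E₁ E₂ E₃ E₄ balance = begin
  countPairs E₁ + countPairs E₂              ≡⟨ cong₂ _+_ (countPairs-∑ E₁) (countPairs-∑ E₂) ⟩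
  ∑∑ (restrict E₁) + ∑∑ (restrict E₂)        ≡⟨ ∑∑-+ (restrict E₁) (restrict E₂) ⟨
  ∑∑ (λ i j → restrict E₁ i j + restrict E₂ i j)
                                             ≡⟨ ∑∑-cong (λ i j → restricted (before i j) (balance i j)) ⟩
  ∑∑ (λ i j → restrict E₃ i j + restrict E₄ i j)
                                             ≡⟨ ∑∑-+ (restrict E₃) (restrict E₄) ⟩
  ∑∑ (restrict E₃) + ∑∑ (restrict E₄)        ≡⟨ cong₂ _+_ (countPairs-∑ E₃) (countPairs-∑ E₄) ⟨
  countPairs E₃ + countPairs E₄              ∎
  where
  open ≡-Reasoning
  restrict : (Fin m → Fin m → Bool) → Fin m → Fin m → ℕ
  restrict E i j = ind (before i j ∧ E i j)
  restricted : ∀ l {a b c d} → ind a + ind b ≡ ind c + ind d →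
               ind (l ∧ a) + ind (l ∧ b) ≡ ind (l ∧ c) + ind (l ∧ d)
  restricted true eq = eq
  restricted false _ = refl

countPairs-single : ∀ {m} (E : Fin m → Fin m → Bool) (p q : Fin m) →
  T (before p q) → T (E p q) → (∀ i j → T (before i j) → T (E i j) → i ≡ p × j ≡ q) →
  countPairs E ≡ 1
countPairs-single {m} E p q pq Epq only = begin
  countPairs E               ≡⟨ countPairs-∑ E ⟩
  ∑∑ term                    ≡⟨ ∑-point (λ i → ∑ (term i)) p row-vanishes ⟩
  ∑ (term p)                 ≡⟨ ∑-point (term p) q (λ j j≢q → vanishes (j≢q ∘ proj₂ ∘ only′ p j)) ⟩
  term p q                   ≡⟨ ind-true (from (T-∧ {before p q} {E p q}) (pq , Epq)) ⟩
  1                          ∎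
  where
  open ≡-Reasoning
  term : Fin m → Fin m → ℕ
  term i j = ind (before i j ∧ E i j)
  vanishes : ∀ {i j} → ¬ T (before i j ∧ E i j) → term i j ≡ 0
  vanishes {i} {j} = ind-false {before i j ∧ E i j}
  only′ : ∀ i j → T (before i j ∧ E i j) → i ≡ p × j ≡ q
  only′ i j = uncurry (only i j) ∘ to (T-∧ {before i j} {E i j})
  row-vanishes : ∀ i → i ≢ p → ∑ (term i) ≡ 0
  row-vanishes i i≢p = ∑-zero (term i) (λ j → vanishes (i≢p ∘ proj₁ ∘ only′ i j))

module Induced (H : Graph) where

  edgesIn : BoolSet (n H) → Fin (n H) → Fin (n H) → Bool
  edgesIn s i j = adj H i j ∧ (s i ∧ s j)

  edge-ends : ∀ s {i j} → T (edgesIn s i j) → T (adj H i j) × T (s i) × T (s j)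
  edge-ends s {i} {j} e =
    let ij , ends = to (T-∧ {adj H i j} {s i ∧ s j}) e in ij , to (T-∧ {s i} {s j}) ends

  edge-intro : ∀ s {i j} → T (adj H i j) → T (s i) → T (s j) → T (edgesIn s i j)
  edge-intro s {i} {j} ij si sj = from (T-∧ {adj H i j} {s i ∧ s j}) (ij , from (T-∧ {s i} {s j}) (si , sj))

  induced : BoolSet (n H) → Subgraph H
  induced s = record
    { S = Vec.tabulate s
    ; E = edgesIn s
    ; Esym = λ i j → cong₂ _∧_ (adj-sym H i j) (∧-comm (s i) (s j))
    ; E⊆H = λ i j e → proj₁ (edge-ends s e)
    ; E⊆S = λ i j e → tabulate-∈ s (proj₁ (proj₂ (edge-ends s e)))
    }

  induced-vertices : ∀ s → subV (induced s) ≡ ∣ s ∣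
  induced-vertices = size-tabulate

  induced-edges-cong : ∀ {s t} → (∀ i → s i ≡ t i) → subE (induced s) ≡ subE (induced t)
  induced-edges-cong s≡t = countPairs-cong (λ i j → cong (adj H i j ∧_) (cong₂ _∧_ (s≡t i) (s≡t j)))

  induced-proper : ∀ {s p} → ¬ T (s p) → Proper (induced s)
  induced-proper {s} {p} ¬sp = inj₁ (p , tabulate-∉ s ¬sp)

  edges-inclusion-exclusion : ∀ s t →
    (∀ i j → T (adj H i j) → (T (s i) × T (s j)) ⊎ (T (t i) × T (t j))) →
    subE (induced s) + subE (induced t) ≡ eCount H + subE (induced (s ∩ t))
  edges-inclusion-exclusion s t covered =
    countPairs-balance (edgesIn s) (edgesIn t) (adj H) (edgesIn (s ∩ t)) λ i j →
      trans (split (adj H i j) (s i ∧ s j) (t i ∧ t j) (both i j))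
            (cong (λ b → ind (adj H i j) + ind (adj H i j ∧ b)) (interchange (s i) (s j) (t i) (t j)))
    where
    open CommutativeSemigroupProperties (CommutativeMonoid.commutativeSemigroup ∧-commutativeMonoid)
      using (interchange)
    split : ∀ a p q → (T a → T p ⊎ T q) → ind (a ∧ p) + ind (a ∧ q) ≡ ind a + ind (a ∧ (p ∧ q))
    split false p q _ = refl
    split true true true _ = refl
    split true true false _ = refl
    split true false true _ = refl
    split true false false cover with cover tt
    ... | inj₁ ()
    ... | inj₂ ()
    both : ∀ i j → T (adj H i j) → T (s i ∧ s j) ⊎ T (t i ∧ t j)
    both i j e with covered i j e
    ... | inj₁ in-s = inj₁ (from (T-∧ {s i} {s j}) in-s)
    ... | inj₂ in-t = inj₂ (from (T-∧ {t i} {t j}) in-t)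

  pair-edges-ordered : ∀ {p q} → T (adj H p q) → T (before p q) → subE (induced (pair p q)) ≡ 1
  pair-edges-ordered {p} {q} pq p<q =
    countPairs-single (edgesIn (pair p q)) p q p<q
      (edge-intro (pair p q) pq (∪-introˡ ⦅ p ⦆ ⦅ q ⦆ p (∈⦅⦆ p)) (∪-introʳ ⦅ p ⦆ ⦅ q ⦆ q (∈⦅⦆ q)))
      only
    where
    only : ∀ i j → T (before i j) → T (edgesIn (pair p q) i j) → i ≡ p × j ≡ q
    only i j i<j e with edge-ends (pair p q) e
    ... | ij , i∈ , j∈ with ∈pair⇒ p q i i∈ | ∈pair⇒ p q j j∈
    ... | inj₁ refl | inj₂ refl = refl , refl
    ... | inj₁ refl | inj₁ refl = ⊥-elim (loop-free H ij)
    ... | inj₂ refl | inj₂ refl = ⊥-elim (loop-free H ij)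
    ... | inj₂ refl | inj₁ refl = ⊥-elim (before-asym {i = p} {q} p<q i<j)

  pair-edges : ∀ {x y} → T (adj H x y) → subE (induced (pair x y)) ≡ 1
  pair-edges {x} {y} xy with ℕₚ.<-cmp (toℕ x) (toℕ y)
  ... | tri< x<y _ _ = pair-edges-ordered xy (ℕₚ.<⇒<ᵇ x<y)
  ... | tri≈ _ x≡y _ = ⊥-elim (adj⇒≢ H xy (Finₚ.toℕ-injective x≡y))
  ... | tri> _ _ y<x =
    trans (induced-edges-cong (λ i → ∨-comm (⦅ x ⦆ i) (⦅ y ⦆ i)))
          (pair-edges-ordered (adj-flip H xy) (ℕₚ.<⇒<ᵇ y<x))

module Separation (H : Graph) {x y : Fin (n H)} (xy : T (adj H x y)) (C : BoolSet (n H))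
  (x∉C : ¬ T (C x)) (y∉C : ¬ T (C y))
  (closed : ∀ u v → T (C u) → T (adj H v u) → v ≢ x × v ≢ y → T (C v)) where

  open Induced H

  side₁ side₂ : BoolSet (n H)
  side₁ = C ∪ pair x y
  side₂ = ∁ C

  exit : ∀ {u v} → T (C u) → T (adj H u v) → ¬ T (C v) → T (side₁ v)
  exit {u} {v} u∈C uv v∉C with T? (pair x y v)
  ... | yes v∈xy = ∪-introʳ C (pair x y) v v∈xy
  ... | no v∉xy = ⊥-elim (v∉C (closed u v u∈C (adj-flip H uv) (v≢x , v≢y)))
    where
    v≢x : v ≢ x
    v≢x refl = v∉xy (∪-introˡ ⦅ x ⦆ ⦅ y ⦆ x (∈⦅⦆ x))
    v≢y : v ≢ y
    v≢y refl = v∉xy (∪-introʳ ⦅ x ⦆ ⦅ y ⦆ y (∈⦅⦆ y))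

  covered : ∀ i j → T (adj H i j) → (T (side₁ i) × T (side₁ j)) ⊎ (T (side₂ i) × T (side₂ j))
  covered i j ij with T? (C i) | T? (C j)
  ... | yes i∈ | yes j∈ = inj₁ (∪-introˡ C (pair x y) i i∈ , ∪-introˡ C (pair x y) j j∈)
  ... | yes i∈ | no j∉ = inj₁ (∪-introˡ C (pair x y) i i∈ , exit i∈ ij j∉)
  ... | no i∉ | yes j∈ = inj₁ (exit j∈ (adj-flip H ij) i∉ , ∪-introˡ C (pair x y) j j∈)
  ... | no i∉ | no j∉ = inj₂ (∁-intro C i i∉ , ∁-intro C j j∉)

  pair⊆side₂ : pair x y ⊆ side₂
  pair⊆side₂ i i∈xy with ∈pair⇒ x y i i∈xy
  ... | inj₁ refl = ∁-intro C x x∉C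
  ... | inj₂ refl = ∁-intro C y y∉C

  sides-meet : ∀ i → (side₁ ∩ side₂) i ≡ pair x y i
  sides-meet i = absorb (C i) (pair x y i) (λ i∈C i∈xy → ∁-elim C i (pair⊆side₂ i i∈xy) i∈C)
    where
    absorb : ∀ c p → (T c → T p → ⊥) → (c ∨ p) ∧ not c ≡ p
    absorb true true disjoint = ⊥-elim (disjoint tt tt)
    absorb true false _ = refl
    absorb false true _ = refl
    absorb false false _ = refl

  vertex-count : subV (induced side₁) + subV (induced side₂) ≡ n H + 2
  vertex-count = begin
    subV (induced side₁) + subV (induced side₂)   ≡⟨ cong₂ _+_ (induced-vertices side₁) (induced-vertices side₂) ⟩
    ∣ side₁ ∣ + ∣ side₂ ∣                         ≡⟨ ∣∣-inclusion-exclusion side₁ side₂ ⟩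
    ∣ side₁ ∪ side₂ ∣ + ∣ side₁ ∩ side₂ ∣         ≡⟨ cong₂ _+_ (∣∣-full everywhere) (∣∣-cong sides-meet) ⟩
    n H + ∣ pair x y ∣                            ≡⟨ cong (n H +_) (∣pair∣ (adj⇒≢ H xy)) ⟩
    n H + 2                                       ∎
    where
    open ≡-Reasoning
    everywhere : ∀ i → T ((side₁ ∪ side₂) i)
    everywhere i with T? (C i)
    ... | yes i∈ = ∪-introˡ side₁ side₂ i (∪-introˡ C (pair x y) i i∈)
    ... | no i∉ = ∪-introʳ side₁ side₂ i (∁-intro C i i∉)

  edge-count : subE (induced side₁) + subE (induced side₂) ≡ eCount H + 1
  edge-count = begin
    subE (induced side₁) + subE (induced side₂)   ≡⟨ edges-inclusion-exclusion side₁ side₂ covered ⟩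
    eCount H + subE (induced (side₁ ∩ side₂))     ≡⟨ cong (eCount H +_) (induced-edges-cong sides-meet) ⟩
    eCount H + subE (induced (pair x y))          ≡⟨ cong (eCount H +_) (pair-edges xy) ⟩
    eCount H + 1                                  ∎
    where open ≡-Reasoning

  big-side : ∀ {s r} → pair x y ⊆ s → T (s r) → r ≢ x → r ≢ y → subV (induced s) ≥ 3
  big-side {s} xy⊆s sr r≢x r≢y =
    subst (3 ≤_) (sym (induced-vertices s)) (∣∣-three (adj⇒≢ H xy) xy⊆s sr r≢x r≢y)

  separation : Strictly2Balanced H → ∀ {c w} → T (C c) → ¬ T (C w) → w ≢ x → w ≢ y → ⊥
  separation (_ , _ , balanced) {c} {w} c∈C w∉C w≢x w≢y =
    ratio-sum-impossible (eCount H) (n H) (subE (induced side₁)) (subV (induced side₁))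
                         (subE (induced side₂)) (subV (induced side₂)) edge-count vertex-count
      (balanced (induced side₁) (induced-proper w∉side₁)
                (big-side (∪-introʳ C (pair x y)) (∪-introˡ C (pair x y) c c∈C) (c≢ x∉C) (c≢ y∉C)))
      (balanced (induced side₂) (induced-proper (λ c∈side₂ → ∁-elim C c c∈side₂ c∈C))
                (big-side pair⊆side₂ (∁-intro C w w∉C) w≢x w≢y))
    where
    c≢ : ∀ {z} → ¬ T (C z) → c ≢ z
    c≢ z∉C refl = z∉C c∈C
    w∉side₁ : ¬ T (side₁ w)
    w∉side₁ w∈ with ∪-elim C (pair x y) w w∈
    ... | inj₁ w∈C = w∉C w∈C
    ... | inj₂ w∈xy = ∉pair w≢x w≢y w∈xy

fact2 : (H : Graph) → Regular H → Strictly2Balanced H → vCount H ≥ 4 →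
        (x y a a' : Fin (n H)) → T (adj H x y) → a ≢ a' →
        a ≢ x → a ≢ y → a' ≢ x → a' ≢ y →
        PathAvoiding H a a' x y
fact2 H _ balanced _ x y a a′ xy _ a≢x a≢y a′≢x a′≢y
  with Component.component H (λ v → ¬? (v Fin.≟ x) ×-dec ¬? (v Fin.≟ y)) a′ (a′≢x , a′≢y)
... | C , walks , a′∈C , closed with T? (C a)
...   | yes a∈C = let _ , w , avoiding = walks a a∈C in Paths.walk⇒path H _ w avoiding
...   | no a∉C = ⊥-elim (Separation.separation H xy C (outside proj₁) (outside proj₂) closed
                   balanced a′∈C a∉C a≢x a≢y)
  where
  outside : ∀ {z} → (∀ {v} → v ≢ x × v ≢ y → v ≢ z) → ¬ T (C z)
  outside avoids z∈C = let _ , w , avoiding = walks _ z∈C in avoids (walk-head w avoiding) refl
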